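{- For every positive integer $n$, $\Psi(Q_n)=M(n)+1$.
   Context: $Q_n$ is the $n$-dimensional hypercube: vertex set $\{0,1\}^n$, two vertices adjacent iff they differ in exactly one coordinate. A set $S$ of vertices of a graph $G$ is doubly resolving if for all distinct vertices $u,v$ there are $x,y\in S$ with $d_G(u,x)-d_G(u,y)\neq d_G(v,x)-d_G(v,y)$; $\Psi(G)$ is the minimum cardinality of a doubly resolving set. A set $S\subseteq\{0,1\}^n$ is a weighing strategy if for every pair of distinct $u,v\in\{0,1\}^n$ there exists $x\in S$ with $u\cdot x\neq v\cdot x$, where $u\cdot x=\sum_{i=1}^n u_ix_i$ (integer sum). $M(n)$ is the minimum cardinality of a weighing strategy (the coin weighing number). -}

module Defs where

open import Data.Nat using (ℕ; zero; suc; _+_; _*_; _≤_)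
open import Data.Integer using (ℤ; _⊖_)
open import Data.Bool using (Bool; true; false; _∧_)
open import Data.Vec using (Vec; []; _∷_)
open import Data.List using (List; length)
open import Data.List.Membership.Propositional using (_∈_)
open import Data.List.Relation.Unary.Unique.Propositional using (Unique)
open import Data.Product using (Σ; ∃; _×_; _,_)
open import Relation.Binary.PropositionalEquality using (_≡_; _≢_)

-- Vertices of the hypercube Q_n: {0,1}^n, with 0 = false, 1 = true.
Vertex : ℕ → Set
Vertex n = Vec Bool n

bit : Bool → ℕ
bit true  = 1
bit false = 0

-- Number of coordinates in which two bit-vectors differ.
-- This is the shortest-path distance d_{Q_n} in the hypercube Q_n
-- (adjacent iff differing in exactly one coordinate).
dist : ∀ {n} → Vertex n → Vertex n → ℕ
dist []       []       = 0
dist (a ∷ u) (b ∷ v) = (if-diff a b) + dist u v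
  where
  if-diff : Bool → Bool → ℕ
  if-diff true  true  = 0
  if-diff false false = 0
  if-diff true  false = 1
  if-diff false true  = 1

dot : ∀ {n} → Vertex n → Vertex n → ℕ
dot []       []       = 0
dot (a ∷ u) (b ∷ v) = bit a * bit b + dot u v

-- A finite set of vertices is represented by a duplicate-free list;
-- its cardinality is the length of the list.

DoublyResolving : (n : ℕ) → List (Vertex n) → Set
DoublyResolving n S =
  (u v : Vertex n) → u ≢ v →
  Σ (Vertex n) λ x → Σ (Vertex n) λ y → x ∈ S × y ∈ S ×
    ((dist u x ⊖ dist u y) ≢ (dist v x ⊖ dist v y))

WeighingStrategy : (n : ℕ) → List (Vertex n) → Set
WeighingStrategy n S =
  (u v : Vertex n) → u ≢ v →
  Σ (Vertex n) λ x → x ∈ S × (dot u x ≢ dot v x)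

IsMinCard : ∀ {n} → (List (Vertex n) → Set) → ℕ → Set
IsMinCard {n} P k =
  (Σ (List (Vertex n)) λ S → Unique S × P S × length S ≡ k) ×
  ((S : List (Vertex n)) → Unique S → P S → k ≤ length S)

Psi≡ : ℕ → ℕ → Set
Psi≡ n k = IsMinCard (DoublyResolving n) k

M≡ : ℕ → ℕ → Set
M≡ n k = IsMinCard (WeighingStrategy n) k

-- Writing |u| for the Hamming weight, d(u,x) + 2 u·x = |u| + |x|, hence
-- d(u,x) − d(u,y) = |x| − |y| − 2 (u·x − u·y). Against the vertex 𝟘 the distance
-- differences therefore recover the weighings u·x, so {𝟘} ∪ W is doubly resolving
-- for every weighing strategy W; conversely a pair x, y distinguishes u from v only
-- if x or y already separates them as a weighing. Translating a doubly resolving S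
-- by one of its elements s (an isometry of Q_n) puts 𝟘 into it, and the remaining
-- |S| − 1 vertices form a weighing strategy. The minimum M(n) exists constructively
-- because being a weighing strategy is decidable and the search space is finite.

module Submission where

open import Defs
open import Data.Bool using (Bool; true; false; _xor_)
open import Data.Bool.Properties using (xor-assoc; xor-comm; xor-identityʳ) renaming (_≟_ to _≟ᴮ_)
open import Data.Empty using (⊥-elim)
open import Data.Integer as ℤ using (_⊖_)
import Data.Integer.Properties as ℤP
open import Data.List using (List; []; _∷_; [_]; length; map; filter; cartesianProductWith)
open import Data.List.Membership.Propositional using (_∈_; find; lose)
open import Data.List.Membership.Propositional.Properties using (∈-map⁺; ∈-filter⁺; ∈-cartesianProductWith⁺; ∈-deduplicate⁺)
open import Data.List.Properties using (length-map; length-filter; filter-notAll)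
open import Data.List.Relation.Unary.All as All using (all?)
open import Data.List.Relation.Unary.All.Properties using (all-filter)
open import Data.List.Relation.Unary.Any as Any using (here; there; any?)
open import Data.List.Relation.Unary.Unique.Propositional using (Unique; _∷_)
import Data.List.Relation.Unary.Unique.Propositional.Properties as Unique
open import Data.List.Relation.Unary.Unique.DecPropositional using (unique?)
open import Data.List.Relation.Unary.Unique.DecPropositional.Properties using (deduplicate-!)
open import Data.Nat using (ℕ; zero; suc; _+_; _*_; _≤_; _<_; _≟_)
open import Data.Nat.Induction using (<-rec)
open import Data.Nat.Properties as ℕP using (+-comm; +-cancelˡ-≡; *-cancelˡ-≡; m+n≡0⇒m≡0; ≤-antisym; ≤-<-trans; ≮⇒≥; anyUpTo?)
open import Data.Product using (Σ; ∃; ∃-syntax; _×_; _,_; proj₂; map₂)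
open import Data.Vec using ([]; _∷_; replicate; zipWith)
open import Data.Vec.Properties using (zipWith-assoc; zipWith-comm; zipWith-identityʳ; ≡-dec)
open import Function using (_∘_)
open import Relation.Binary.PropositionalEquality using (_≡_; _≢_; refl; sym; trans; cong; cong₂; subst; ≢-sym; module ≡-Reasoning)
open import Relation.Nullary using (Dec; yes; no; ¬?)
open import Relation.Nullary.Decidable using (map′; _×-dec_; _→-dec_)
open import Relation.Unary using (Decidable)
open import Algebra.Properties.AbelianGroup ℤP.+-0-abelianGroup using (//-rightDividesˡ)
import Algebra.Properties.CommutativeSemigroup ℤP.+-commutativeSemigroup as ℤ+
open import Algebra.Properties.CommutativeSemigroup ℕP.+-commutativeSemigroup using (x∙yz≈xz∙y; xy∙z≈y∙xz; x∙yz≈y∙xz)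

private
  variable
    n : ℕ

-- ℤ's +_ is opened only locally, since it makes sections such as (x +_) ambiguous.
module _ where
  open ℤ using (+_)

  m⊖n+n≡m : ∀ m n → m ⊖ n ℤ.+ + n ≡ + m
  m⊖n+n≡m m n = trans (cong (ℤ._+ + n) (sym (ℤP.m-n≡m⊖n m n))) (//-rightDividesˡ (+ n) (+ m))

  m⊖n≡o⊖p⇒m+p≡o+n : ∀ m n o p → m ⊖ n ≡ o ⊖ p → m + p ≡ o + n
  m⊖n≡o⊖p⇒m+p≡o+n m n o p eq = ℤP.+-injective (begin
    + (m + p)               ≡⟨ cong (ℤ._+ + p) (sym (m⊖n+n≡m m n)) ⟩
    m ⊖ n ℤ.+ + n ℤ.+ + p   ≡⟨ cong (λ i → i ℤ.+ + n ℤ.+ + p) eq ⟩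
    o ⊖ p ℤ.+ + n ℤ.+ + p   ≡⟨ ℤ+.xy∙z≈xz∙y (o ⊖ p) (+ n) (+ p) ⟩
    o ⊖ p ℤ.+ + p ℤ.+ + n   ≡⟨ cong (ℤ._+ + n) (m⊖n+n≡m o p) ⟩
    + (o + n)               ∎)
    where open ≡-Reasoning

m+p≡o+n⇒m⊖n≡o⊖p : ∀ m n o p → m + p ≡ o + n → m ⊖ n ≡ o ⊖ p
m+p≡o+n⇒m⊖n≡o⊖p m n o p eq = begin
  m ⊖ n              ≡⟨ ℤP.+-cancelˡ-⊖ p m n ⟨
  (p + m) ⊖ (p + n)  ≡⟨ cong₂ _⊖_ (trans (+-comm p m) eq) (+-comm p n) ⟩
  (o + n) ⊖ (n + p)  ≡⟨ cong (_⊖ (n + p)) (+-comm o n) ⟩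
  (n + o) ⊖ (n + p)  ≡⟨ ℤP.+-cancelˡ-⊖ n o p ⟩
  o ⊖ p              ∎
  where open ≡-Reasoning

module _ {P : ℕ → Set} (P? : Decidable P) where

  least-satisfier : ∀ {k} → P k → ∃[ m ] P m × (∀ {j} → P j → m ≤ j)
  least-satisfier {k} = <-rec (λ k → P k → ∃[ m ] P m × (∀ {j} → P j → m ≤ j)) step k
    where
    step : ∀ k → (∀ {i} → i < k → P i → ∃[ m ] P m × (∀ {j} → P j → m ≤ j)) →
           P k → ∃[ m ] P m × (∀ {j} → P j → m ≤ j)
    step k below Pk with anyUpTo? P? k
    ... | yes (i , i<k , Pi) = below i<k Pi
    ... | no  ∄i<k          = k , Pk , λ Pj → ≮⇒≥ (λ j<k → ∄i<k (_ , j<k , Pj))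

listsOfLength : ∀ {A : Set} → List A → ℕ → List (List A)
listsOfLength xs zero    = [ [] ]
listsOfLength xs (suc k) = cartesianProductWith _∷_ xs (listsOfLength xs k)

module _ {A : Set} {xs : List A} (complete : ∀ x → x ∈ xs) where

  ∈-listsOfLength : ∀ ys → ys ∈ listsOfLength xs (length ys)
  ∈-listsOfLength []       = here refl
  ∈-listsOfLength (y ∷ ys) = ∈-cartesianProductWith⁺ _∷_ (complete y) (∈-listsOfLength ys)

  ∀? : ∀ {P : A → Set} → Decidable P → Dec (∀ x → P x)
  ∀? P? = map′ (λ all x → All.lookup all (complete x)) (λ ∀P → All.tabulate (λ {x} _ → ∀P x)) (all? P? xs)

  ∃-ofLength? : ∀ {Q : List A → Set} → Decidable Q → ∀ k → Dec (∃ λ ys → Q ys × length ys ≡ k)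
  ∃-ofLength? Q? k = map′
    (map₂ proj₂ ∘ find)
    (λ { (ys , Qys , refl) → lose (∈-listsOfLength ys) (Qys , refl) })
    (any? (λ ys → Q? ys ×-dec (length ys ≟ k)) (listsOfLength xs k))

minCard-exists : ∀ {P : List (Vertex n) → Set} → (∀ k → Dec (∃ λ S → (Unique S × P S) × length S ≡ k)) →
                 ∀ {S} → Unique S → P S → ∃[ m ] IsMinCard P m
minCard-exists ofSize? {S} unique PS with least-satisfier ofSize? (S , (unique , PS) , refl)
... | m , (S₀ , (unique₀ , PS₀) , |S₀|≡m) , minimal =
  m , (S₀ , unique₀ , PS₀ , |S₀|≡m) , λ S′ unique′ PS′ → minimal (S′ , (unique′ , PS′) , refl)

𝟘 : Vertex n
𝟘 {n} = replicate n false

weight : Vertex n → ℕ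
weight u = dist u 𝟘

_⊕_ : Vertex n → Vertex n → Vertex n
_⊕_ = zipWith _xor_

⊕-assoc : ∀ (u v w : Vertex n) → (u ⊕ v) ⊕ w ≡ u ⊕ (v ⊕ w)
⊕-assoc = zipWith-assoc xor-assoc

⊕-comm : ∀ (u v : Vertex n) → u ⊕ v ≡ v ⊕ u
⊕-comm = zipWith-comm xor-comm

⊕-identityʳ : ∀ (u : Vertex n) → u ⊕ 𝟘 ≡ u
⊕-identityʳ = zipWith-identityʳ xor-identityʳ

⊕-self : ∀ (u : Vertex n) → u ⊕ u ≡ 𝟘
⊕-self []          = refl
⊕-self (true ∷ u)  = cong (false ∷_) (⊕-self u)
⊕-self (false ∷ u) = cong (false ∷_) (⊕-self u)

⊕-cancelʳ : ∀ (u s : Vertex n) → (u ⊕ s) ⊕ s ≡ u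
⊕-cancelʳ u s = begin
  (u ⊕ s) ⊕ s  ≡⟨ ⊕-assoc u s s ⟩
  u ⊕ (s ⊕ s)  ≡⟨ cong (u ⊕_) (⊕-self s) ⟩
  u ⊕ 𝟘        ≡⟨ ⊕-identityʳ u ⟩
  u            ∎
  where open ≡-Reasoning

⊕-injectiveˡ : ∀ (s : Vertex n) {u v} → u ⊕ s ≡ v ⊕ s → u ≡ v
⊕-injectiveˡ s {u} {v} eq = trans (sym (⊕-cancelʳ u s)) (trans (cong (_⊕ s) eq) (⊕-cancelʳ v s))

dist-self : ∀ (u : Vertex n) → dist u u ≡ 0
dist-self []          = refl
dist-self (true ∷ u)  = dist-self u
dist-self (false ∷ u) = dist-self u

dist≡0⇒≡ : ∀ {u v : Vertex n} → dist u v ≡ 0 → u ≡ v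
dist≡0⇒≡ {u = []}        {[]}        _  = refl
dist≡0⇒≡ {u = true ∷ u}  {true ∷ v}  eq = cong (true ∷_) (dist≡0⇒≡ eq)
dist≡0⇒≡ {u = false ∷ u} {false ∷ v} eq = cong (false ∷_) (dist≡0⇒≡ eq)

dist≡weight-⊕ : ∀ (u v : Vertex n) → dist u v ≡ weight (u ⊕ v)
dist≡weight-⊕ []          []          = refl
dist≡weight-⊕ (true ∷ u)  (true ∷ v)  = dist≡weight-⊕ u v
dist≡weight-⊕ (true ∷ u)  (false ∷ v) = cong suc (dist≡weight-⊕ u v)
dist≡weight-⊕ (false ∷ u) (true ∷ v)  = cong suc (dist≡weight-⊕ u v)
dist≡weight-⊕ (false ∷ u) (false ∷ v) = dist≡weight-⊕ u v

dist-comm : ∀ (u v : Vertex n) → dist u v ≡ dist v u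
dist-comm u v = begin
  dist u v        ≡⟨ dist≡weight-⊕ u v ⟩
  weight (u ⊕ v)  ≡⟨ cong weight (⊕-comm u v) ⟩
  weight (v ⊕ u)  ≡⟨ dist≡weight-⊕ v u ⟨
  dist v u        ∎
  where open ≡-Reasoning

dist-⊕-swap : ∀ (u x s : Vertex n) → dist (u ⊕ s) x ≡ dist u (x ⊕ s)
dist-⊕-swap u x s = begin
  dist (u ⊕ s) x        ≡⟨ dist≡weight-⊕ (u ⊕ s) x ⟩
  weight ((u ⊕ s) ⊕ x)  ≡⟨ cong weight (⊕-assoc u s x) ⟩
  weight (u ⊕ (s ⊕ x))  ≡⟨ cong (λ t → weight (u ⊕ t)) (⊕-comm s x) ⟩
  weight (u ⊕ (x ⊕ s))  ≡⟨ dist≡weight-⊕ u (x ⊕ s) ⟨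
  dist u (x ⊕ s)        ∎
  where open ≡-Reasoning

dot-zeroʳ : ∀ (u : Vertex n) → dot u 𝟘 ≡ 0
dot-zeroʳ []          = refl
dot-zeroʳ (true ∷ u)  = dot-zeroʳ u
dot-zeroʳ (false ∷ u) = dot-zeroʳ u

dist+2*dot≡weight+weight : ∀ (u x : Vertex n) → dist u x + 2 * dot u x ≡ weight u + weight x
dist+2*dot≡weight+weight []          []          = refl
dist+2*dot≡weight+weight (true ∷ u)  (true ∷ x)  = begin
  dist u x + 2 * suc (dot u x)         ≡⟨ cong (dist u x +_) (ℕP.*-suc 2 (dot u x)) ⟩
  dist u x + (2 + 2 * dot u x)         ≡⟨ x∙yz≈y∙xz (dist u x) 2 (2 * dot u x) ⟩
  2 + (dist u x + 2 * dot u x)         ≡⟨ cong (2 +_) (dist+2*dot≡weight+weight u x) ⟩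
  2 + (weight u + weight x)            ≡⟨ cong suc (ℕP.+-suc (weight u) (weight x)) ⟨
  suc (weight u + suc (weight x))      ∎
  where open ≡-Reasoning
dist+2*dot≡weight+weight (true ∷ u)  (false ∷ x) = cong suc (dist+2*dot≡weight+weight u x)
dist+2*dot≡weight+weight (false ∷ u) (true ∷ x)  = trans (cong suc (dist+2*dot≡weight+weight u x)) (sym (ℕP.+-suc (weight u) (weight x)))
dist+2*dot≡weight+weight (false ∷ u) (false ∷ x) = dist+2*dot≡weight+weight u x

dist⊖dist : ∀ (u x y : Vertex n) →
            dist u x ⊖ dist u y ≡ (weight x + 2 * dot u y) ⊖ (weight y + 2 * dot u x)
dist⊖dist u x y =
  m+p≡o+n⇒m⊖n≡o⊖p (dist u x) (dist u y) (weight x + 2 * dot u y) (weight y + 2 * dot u x) (begin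
  dist u x + (weight y + 2 * dot u x)  ≡⟨ x∙yz≈xz∙y (dist u x) (weight y) (2 * dot u x) ⟩
  dist u x + 2 * dot u x + weight y    ≡⟨ cong (_+ weight y) (dist+2*dot≡weight+weight u x) ⟩
  weight u + weight x + weight y       ≡⟨ xy∙z≈y∙xz (weight u) (weight x) (weight y) ⟩
  weight x + (weight u + weight y)     ≡⟨ cong (weight x +_) (dist+2*dot≡weight+weight u y) ⟨
  weight x + (dist u y + 2 * dot u y)  ≡⟨ x∙yz≈xz∙y (weight x) (dist u y) (2 * dot u y) ⟩
  weight x + 2 * dot u y + dist u y    ∎)
  where open ≡-Reasoning

dot≡⇒dist⊖dist≡ : ∀ (u v x y : Vertex n) → dot u x ≡ dot v x → dot u y ≡ dot v y →
                  dist u x ⊖ dist u y ≡ dist v x ⊖ dist v y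
dot≡⇒dist⊖dist≡ u v x y ux≡vx uy≡vy = begin
  dist u x ⊖ dist u y                                ≡⟨ dist⊖dist u x y ⟩
  (weight x + 2 * dot u y) ⊖ (weight y + 2 * dot u x) ≡⟨ cong₂ (λ p q → (weight x + 2 * q) ⊖ (weight y + 2 * p)) ux≡vx uy≡vy ⟩
  (weight x + 2 * dot v y) ⊖ (weight y + 2 * dot v x) ≡⟨ dist⊖dist v x y ⟨
  dist v x ⊖ dist v y                                ∎
  where open ≡-Reasoning

dist⊖dist≡⇒dot≡ : ∀ (u v x y : Vertex n) → dot u y ≡ dot v y →
                  dist u x ⊖ dist u y ≡ dist v x ⊖ dist v y → dot u x ≡ dot v x
dist⊖dist≡⇒dot≡ u v x y uy≡vy eq =
  sym (*-cancelˡ-≡ (dot v x) (dot u x) 2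
    (+-cancelˡ-≡ (weight y) _ _ (+-cancelˡ-≡ (weight x + 2 * dot v y) _ _ sums≡)))
  where
  open ≡-Reasoning
  sums≡ : weight x + 2 * dot v y + (weight y + 2 * dot v x) ≡ weight x + 2 * dot v y + (weight y + 2 * dot u x)
  sums≡ = begin
    weight x + 2 * dot v y + (weight y + 2 * dot v x)
      ≡⟨ cong (λ p → weight x + 2 * p + (weight y + 2 * dot v x)) uy≡vy ⟨
    weight x + 2 * dot u y + (weight y + 2 * dot v x)
      ≡⟨ m⊖n≡o⊖p⇒m+p≡o+n (weight x + 2 * dot u y) (weight y + 2 * dot u x)
                         (weight x + 2 * dot v y) (weight y + 2 * dot v x)
                         (trans (sym (dist⊖dist u x y)) (trans eq (dist⊖dist v x y))) ⟩
    weight x + 2 * dot v y + (weight y + 2 * dot u x)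
      ∎

_≟ᵛ_ : (u v : Vertex n) → Dec (u ≡ v)
_≟ᵛ_ = ≡-dec _≟ᴮ_

nonzero? : Decidable {A = Vertex n} (_≢ 𝟘)
nonzero? u = ¬? (u ≟ᵛ 𝟘)

𝟘∷weighing⇒doublyResolving : ∀ {W} → WeighingStrategy n W → DoublyResolving n (𝟘 ∷ W)
𝟘∷weighing⇒doublyResolving weighs u v u≢v with weighs u v u≢v
... | x , x∈W , ux≢vx =
  x , 𝟘 , there x∈W , here refl , ux≢vx ∘ dist⊖dist≡⇒dot≡ u v x 𝟘 (trans (dot-zeroʳ u) (sym (dot-zeroʳ v)))

doublyResolving⇒weighing : ∀ {S} → DoublyResolving n S → WeighingStrategy n S
doublyResolving⇒weighing resolves u v u≢v with resolves u v u≢v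
... | x , y , x∈S , y∈S , resolved with dot u x ≟ dot v x | dot u y ≟ dot v y
...   | no ux≢vx | _        = x , x∈S , ux≢vx
...   | yes _    | no uy≢vy = y , y∈S , uy≢vy
...   | yes ux≡vx | yes uy≡vy = ⊥-elim (resolved (dot≡⇒dist⊖dist≡ u v x y ux≡vx uy≡vy))

doublyResolving-⊕ : ∀ {S} (s : Vertex n) → DoublyResolving n S → DoublyResolving n (map (_⊕ s) S)
doublyResolving-⊕ s resolves u v u≢v with resolves (u ⊕ s) (v ⊕ s) (u≢v ∘ ⊕-injectiveˡ s)
... | x , y , x∈S , y∈S , resolved =
  x ⊕ s , y ⊕ s , ∈-map⁺ (_⊕ s) x∈S , ∈-map⁺ (_⊕ s) y∈S ,
  λ eq → resolved (trans (swap u) (trans eq (sym (swap v))))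
  where
  swap : ∀ w → dist (w ⊕ s) x ⊖ dist (w ⊕ s) y ≡ dist w (x ⊕ s) ⊖ dist w (y ⊕ s)
  swap w = cong₂ _⊖_ (dist-⊕-swap w x s) (dist-⊕-swap w y s)

weighing-filter-nonzero : ∀ {S} → WeighingStrategy n S → WeighingStrategy n (filter nonzero? S)
weighing-filter-nonzero weighs u v u≢v with weighs u v u≢v
... | x , x∈S , ux≢vx = x , ∈-filter⁺ nonzero? x∈S x≢𝟘 , ux≢vx
  where
  x≢𝟘 : x ≢ 𝟘
  x≢𝟘 refl = ux≢vx (trans (dot-zeroʳ u) (sym (dot-zeroʳ v)))

complete⇒weighing : ∀ {S} → (∀ v → v ∈ S) → WeighingStrategy n S
complete⇒weighing complete u v u≢v with dot u u ≟ dot v u | dot u v ≟ dot v v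
... | no uu≢vu | _        = u , complete u , uu≢vu
... | yes _    | no uv≢vv = v , complete v , uv≢vv
... | yes uu≡vu | yes uv≡vv =
  ⊥-elim (u≢v (dist≡0⇒≡ (m+n≡0⇒m≡0 (dist u v) (sym (m⊖n≡o⊖p⇒m+p≡o+n 0 (dist u v) (dist u v) 0 0⊖d≡d⊖0)))))
  where
  open ≡-Reasoning
  0⊖d≡d⊖0 : 0 ⊖ dist u v ≡ dist u v ⊖ 0
  0⊖d≡d⊖0 = begin
    0 ⊖ dist u v         ≡⟨ cong (_⊖ dist u v) (dist-self u) ⟨
    dist u u ⊖ dist u v  ≡⟨ dot≡⇒dist⊖dist≡ u v u v uu≡vu uv≡vv ⟩
    dist v u ⊖ dist v v  ≡⟨ cong₂ _⊖_ (dist-comm v u) (dist-self v) ⟩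
    dist u v ⊖ 0         ∎

doublyResolving⇒shorter-weighing : ∀ {S} → DoublyResolving (suc n) S → Unique S →
                   Σ (List (Vertex (suc n))) λ W → Unique W × WeighingStrategy (suc n) W × length W < length S
doublyResolving⇒shorter-weighing {S = S} resolves unique with resolves 𝟘 (true ∷ 𝟘) (λ ())
... | s , _ , s∈S , _ =
  -- this is the only use of n ≥ 1: resolving some pair, S has an element s
  filter nonzero? T ,
  Unique.filter⁺ nonzero? (Unique.map⁺ (⊕-injectiveˡ s) unique) ,
  weighing-filter-nonzero (doublyResolving⇒weighing (doublyResolving-⊕ s resolves)) ,
  subst (length (filter nonzero? T) <_) (length-map (_⊕ s) S)
    (filter-notAll nonzero? T (Any.map (λ 𝟘≡x x≢𝟘 → x≢𝟘 (sym 𝟘≡x)) 𝟘∈T))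
  where
  T = map (_⊕ s) S
  𝟘∈T : 𝟘 ∈ T
  𝟘∈T = subst (_∈ T) (⊕-self s) (∈-map⁺ (_⊕ s) s∈S)

doublyResolving-of-length-suc : ∀ {m} → M≡ n m →
  Σ (List (Vertex n)) λ S → Unique S × DoublyResolving n S × length S ≡ m + 1
doublyResolving-of-length-suc {m = m} ((W , unique , weighs , refl) , minimal) =
  𝟘 ∷ W′ ,
  All.map ≢-sym (all-filter nonzero? W) ∷ unique′ ,
  𝟘∷weighing⇒doublyResolving weighs′ ,
  trans (cong suc |W′|≡m) (+-comm 1 m)
  where
  W′ = filter nonzero? W
  unique′ = Unique.filter⁺ nonzero? unique
  weighs′ = weighing-filter-nonzero weighs
  |W′|≡m : length W′ ≡ m
  |W′|≡m = ≤-antisym (length-filter nonzero? W) (minimal W′ unique′ weighs′)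

bools : List Bool
bools = true ∷ false ∷ []

∈-bools : ∀ b → b ∈ bools
∈-bools true  = here refl
∈-bools false = there (here refl)

vertices : ∀ n → List (Vertex n)
vertices zero    = [ [] ]
vertices (suc n) = cartesianProductWith _∷_ bools (vertices n)

∈-vertices : ∀ (v : Vertex n) → v ∈ vertices n
∈-vertices []      = here refl
∈-vertices (b ∷ v) = ∈-cartesianProductWith⁺ _∷_ (∈-bools b) (∈-vertices v)

weighingStrategy? : ∀ n (S : List (Vertex n)) → Dec (WeighingStrategy n S)
weighingStrategy? n S = ∀? ∈-vertices λ u → ∀? ∈-vertices λ v → ¬? (u ≟ᵛ v) →-dec separated? u v
  where
  separated? : ∀ u v → Dec (Σ (Vertex n) λ x → x ∈ S × dot u x ≢ dot v x)
  separated? u v = map′ find (λ (x , x∈S , ux≢vx) → lose x∈S ux≢vx) (any? (λ x → ¬? (dot u x ≟ dot v x)) S)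

M-exists : ∀ n → ∃[ m ] M≡ n m
M-exists n = minCard-exists
  (∃-ofLength? ∈-vertices (λ S → unique? _≟ᵛ_ S ×-dec weighingStrategy? n S))
  (deduplicate-! _≟ᵛ_ (vertices n))
  (complete⇒weighing (∈-deduplicate⁺ _≟ᵛ_ ∘ ∈-vertices))

theorem8 : (n : ℕ) → 1 ≤ n →
    Σ ℕ λ m → M≡ n m × Psi≡ n (m + 1)
theorem8 zero    ()
theorem8 (suc n) _ with M-exists (suc n)
... | m , M≡m@(_ , minimal) = m , M≡m , doublyResolving-of-length-suc M≡m , at-least-m+1
  where
  at-least-m+1 : ∀ S → Unique S → DoublyResolving (suc n) S → m + 1 ≤ length S
  at-least-m+1 S unique resolves with doublyResolving⇒shorter-weighing resolves unique
  ... | W , uniqueW , weighs , |W|<|S| =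
    subst (_≤ length S) (+-comm 1 m) (≤-<-trans (minimal W uniqueW weighs) |W|<|S|)
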